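{- Let $G$ be a graph and $\mathcal{G}$ the unlabeled graph containing $G$. Suppose that for every $\pi\in\mathrm{Aut}(G)$ other than the identity, some cycle in the cycle decomposition of $\pi$ contains two vertices adjacent in $G$. Then for any $k\in\mathbb{N}$, if $P_{\ell}(G,k) = P(G,k)$, then $P_{\ell}(\mathcal{G},k) = P(\mathcal{G},k)$.
   Context: All graphs are finite and simple. $P(G,k)$ is the chromatic polynomial (number of proper colorings of $G$ from $[k]$), and $P_\ell(G,k)$ is the list color function: the minimum, over all $k$-assignments $L$ of $G$ (each vertex gets a list of $k$ colors), of the number of proper $L$-colorings of $G$. An unlabeled graph $\mathcal{G}$ of order $n$ is an isomorphism class of graphs with vertex set $\{v_1,\ldots,v_n\}$. For a $k$-assignment $L$ of $G$, two proper $L$-colorings $f,g$ are equivalent if $f\pi=g$ for some $\pi\in\mathrm{Aut}(G)$; $u_\ell(G,L)$ is the number of equivalence classes, and $P_\ell(\mathcal{G},k)$ is the minimum of $u_\ell(G,L)$ over all $k$-assignments $L$ of $G$. $P(\mathcal{G},k)$ (Hanlon's unlabeled chromatic polynomial) is the number of orbits of $S_n$ acting on pairs $(H,f)$, $H\in\mathcal{G}$, $f$ a proper coloring of $H$ from $[k]$, via $\pi\cdot(H,f)=(\pi H, f\pi^{ -1})$ with $E(\pi H)=\{\pi(v_i)\pi(v_j): v_iv_j\in E(H)\}$; equivalently it is $u_\ell(G,L)$ for $L(v)=[k]$ for all $v$. -}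

module Defs where

open import Data.Nat using (ℕ; zero; suc; _≤_; _<_)
open import Data.Fin using (Fin; toℕ)
open import Data.Bool using (Bool; true; false)
open import Data.Product using (Σ; ∃; ∃-syntax; _×_; _,_)
open import Data.Fin.Permutation using (Permutation′; _⟨$⟩ʳ_; _⟨$⟩ˡ_)
open import Function.Definitions using (Injective)
open import Relation.Binary.PropositionalEquality using (_≡_)
open import Relation.Nullary using (¬_)

record Graph (n : ℕ) : Set where
  field
    adj    : Fin n → Fin n → Bool
    sym    : ∀ u v → adj u v ≡ adj v u
    irrefl : ∀ v → adj v v ≡ false
open Graph public

Adjacent : ∀ {n} → Graph n → Fin n → Fin n → Set
Adjacent G u v = adj G u v ≡ true

IsAut : ∀ {n} → Graph n → Permutation′ n → Set
IsAut G π = ∀ u v → adj G (π ⟨$⟩ʳ u) (π ⟨$⟩ʳ v) ≡ adj G u v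

IsIdentity : ∀ {n} → Permutation′ n → Set
IsIdentity π = ∀ v → π ⟨$⟩ʳ v ≡ v

iter : ∀ {n} → Permutation′ n → ℕ → Fin n → Fin n
iter π zero    v = v
iter π (suc m) v = π ⟨$⟩ʳ (iter π m v)

-- some cycle of π contains two vertices u, v adjacent in G
-- (u and v lie in the same cycle iff v = π^m(u) for some m)
SomeCycleHasEdge : ∀ {n} → Graph n → Permutation′ n → Set
SomeCycleHasEdge G π = ∃[ u ] ∃[ v ] ∃[ m ] (Adjacent G u v × iter π m u ≡ v)

-- Counting equivalence classes, relationally:
-- NumClasses P R m  means the elements of A satisfying P fall into exactly m
-- R-classes: there are m representatives satisfying P, pairwise
-- R-inequivalent, such that every element satisfying P is R-related to one.
NumClasses : {A : Set} → (A → Set) → (A → A → Set) → ℕ → Set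
NumClasses {A} P R m =
  Σ (Fin m → A) λ rep →
    (∀ i → P (rep i)) ×
    (∀ i j → R (rep i) (rep j) → i ≡ j) ×
    (∀ x → P x → ∃[ i ] R x (rep i))

Coloring : ℕ → Set
Coloring n = Fin n → ℕ

_≗c_ : ∀ {n} → Coloring n → Coloring n → Set
f ≗c g = ∀ v → f v ≡ g v

record Assignment (n k : ℕ) : Set where
  field
    list     : Fin n → Fin k → ℕ
    distinct : ∀ v → Injective _≡_ _≡_ (list v)
open Assignment public

fullAssignment : (n k : ℕ) → Assignment n k
fullAssignment n k = record
  { list = λ _ j → suc (toℕ j)
  ; distinct = λ _ eq → Data.Fin.Properties.toℕ-injective (Data.Nat.Properties.suc-injective eq) }
  where import Data.Fin.Properties
        import Data.Nat.Properties

IsProper : ∀ {n} → Graph n → Coloring n → Set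
IsProper G f = ∀ u v → Adjacent G u v → ¬ (f u ≡ f v)

IsProperL : ∀ {n k} → Graph n → Assignment n k → Coloring n → Set
IsProperL G L f = (∀ v → ∃[ j ] list L v j ≡ f v) × IsProper G f

NumLColorings : ∀ {n k} → Graph n → Assignment n k → ℕ → Set
NumLColorings G L m = NumClasses (IsProperL G L) _≗c_ m

ChromPoly : ∀ {n} → Graph n → ℕ → ℕ → Set
ChromPoly {n} G k m = NumLColorings G (fullAssignment n k) m

ListColorFn : ∀ {n} → Graph n → ℕ → ℕ → Set
ListColorFn {n} G k m =
  (∃[ L ] NumLColorings {n} {k} G L m) ×
  (∀ (L : Assignment n k) c → NumLColorings G L c → m ≤ c)

AutEquiv : ∀ {n} → Graph n → Coloring n → Coloring n → Set
AutEquiv G f g = ∃[ π ] (IsAut G π × (∀ v → f (π ⟨$⟩ʳ v) ≡ g v))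

UnlabeledLCount : ∀ {n k} → Graph n → Assignment n k → ℕ → Set
UnlabeledLCount G L m = NumClasses (IsProperL G L) (AutEquiv G) m

UnlabeledListColorFn : ∀ {n} → Graph n → ℕ → ℕ → Set
UnlabeledListColorFn {n} G k m =
  (∃[ L ] UnlabeledLCount {n} {k} G L m) ×
  (∀ (L : Assignment n k) c → UnlabeledLCount G L c → m ≤ c)

-- Hanlon's unlabeled chromatic polynomial, via its definition as the number
-- of S_n-orbits of pairs (H,f), H ∈ 𝒢 (the isomorphism class of G), f a
-- proper coloring of H from [k] = {1,…,k}.
Pair : ℕ → Set
Pair n = (Fin n → Fin n → Bool) × Coloring n

-- adjacency of πH:  π(v_i)π(v_j) ∈ E(πH)  iff  v_i v_j ∈ E(H)
permAdj : ∀ {n} → Permutation′ n → (Fin n → Fin n → Bool) → Fin n → Fin n → Bool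
permAdj π h x y = h (π ⟨$⟩ˡ x) (π ⟨$⟩ˡ y)

IsHanlonPair : ∀ {n} → Graph n → ℕ → Pair n → Set
IsHanlonPair G k (h , f) =
  (∃[ σ ] (∀ x y → h x y ≡ permAdj σ (adj G) x y)) ×
  (∀ v → 1 ≤ f v × f v ≤ k) ×
  (∀ u v → h u v ≡ true → ¬ (f u ≡ f v))

SameOrbit : ∀ {n} → Pair n → Pair n → Set
SameOrbit (h , f) (h' , f') =
  ∃[ π ] ((∀ x y → h' x y ≡ permAdj π h x y) × (∀ x → f' x ≡ f (π ⟨$⟩ˡ x)))

UnlabeledChromPoly : ∀ {n} → Graph n → ℕ → ℕ → Set
UnlabeledChromPoly G k m = NumClasses (IsHanlonPair G k) SameOrbit m

{-# OPTIONS --safe #-}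
-- Under the cycle hypothesis Aut(G) acts freely on proper colorings: an
-- automorphism fixing a proper coloring f is constant on each of its cycles,
-- so a cycle through an edge would give that edge two equal colors. Let
-- a = |Aut(G)|. Hanlon's orbits correspond to the Aut(G)-classes of proper
-- [k]-colorings, and by freeness each class has exactly a members, so
-- P(𝒢,k) · a ≤ P(G,k). For any k-assignment L, each Aut(G)-class of proper
-- L-colorings has at most a members, so
-- P(G,k) = P_ℓ(G,k) ≤ #(proper L-colorings) ≤ u_ℓ(G,L) · a.
-- Cancelling a gives P(𝒢,k) ≤ u_ℓ(G,L), with equality for L(v) = [k].
module Submission where

open import Defs hiding (sym)
open import Data.Bool using (Bool; true)
open import Data.Bool.Properties using () renaming (_≟_ to _≟ᵇ_)
open import Data.Fin
  using (Fin; zero; suc; toℕ; fromℕ<; combine; quotient; remainder; finToFun; funToFin)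
open import Data.Fin.Permutation
  using (Permutation′; _⟨$⟩ʳ_; _⟨$⟩ˡ_; _≈_; permutation; inverseˡ; inverseʳ; flip; _∘ₚ_; id)
open import Data.Fin.Properties
  using ( all?; any?; injective⇒≤; remQuot-combine; combine-remQuot
        ; funToFin-finToFin; finToFun-funToFin; toℕ<n; toℕ-fromℕ<)
  renaming (_≟_ to _≟ᶠ_)
open import Data.List using (List; filter; lookup; length; allFin)
open import Data.List.Membership.Propositional.Properties
  using (∈-lookup; ∈-filter⁺; ∈-filter⁻; ∈-allFin)
import Data.List.Relation.Unary.All as All
open import Data.List.Relation.Unary.AllPairs using (_∷_)
open import Data.List.Relation.Unary.Any using (index)
open import Data.List.Relation.Unary.Any.Properties using (lookup-index)
open import Data.List.Relation.Unary.Unique.Propositional using (Unique)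
open import Data.List.Relation.Unary.Unique.Propositional.Properties
  using (allFin⁺; filter⁺)
open import Data.Nat using (ℕ; zero; suc; _≤_; _*_; _^_; NonZero; z≤n; s≤s)
open import Data.Nat.Properties using (*-cancelʳ-≤; module ≤-Reasoning) renaming (_≟_ to _≟ⁿ_)
open import Data.Product using (∃-syntax; _×_; _,_; proj₁; proj₂)
open import Function using (_∘_)
open import Function.Definitions using (Injective)
open import Relation.Binary.Bundles using (Setoid)
open import Relation.Binary.PropositionalEquality
open import Relation.Binary.Structures using (IsEquivalence)
open import Relation.Nullary using (¬_; contradiction)
open import Relation.Nullary.Decidable using (_×-dec_; _→-dec_; ¬?; decidable-stable)
open import Relation.Unary using (Decidable)

numClasses-transport :
  {A B : Set} {P : A → Set} {R : A → A → Set} {Q : B → Set} {S : B → B → Set}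
  (f : ∀ x → P x → B) (g : ∀ y → Q y → A) →
  (∀ x p → Q (f x p)) →
  (∀ x x′ p p′ → S (f x p) (f x′ p′) → R x x′) →
  (∀ y q → P (g y q)) →
  (∀ y q x p → R (g y q) x → S y (f x p)) →
  ∀ {m} → NumClasses P R m → NumClasses Q S m
numClasses-transport f g f-Q f-reflects g-P g-covers (rep , rep-P , rep-sep , cover) =
  (λ i → f (rep i) (rep-P i)) ,
  (λ i → f-Q (rep i) (rep-P i)) ,
  (λ i j e → rep-sep i j (f-reflects _ _ _ _ e)) ,
  λ y q → let (i , r) = cover (g y q) (g-P y q) in i , g-covers y q (rep i) (rep-P i) r

numClasses-nonZero : {A : Set} {P : A → Set} {R : A → A → Set} {m : ℕ} {x : A} →
  NumClasses P R m → P x → NonZero m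
numClasses-nonZero {m = suc _} _ _ = _
numClasses-nonZero {m = zero} (_ , _ , _ , cover) px with () ← proj₁ (cover _ px)

separated-≤-covering : {A : Set} {R : A → A → Set} → IsEquivalence R →
  ∀ {m N} (x : Fin m → A) (y : Fin N → A) →
  (∀ i j → R (x i) (x j) → i ≡ j) → (∀ i → ∃[ t ] R (x i) (y t)) → m ≤ N
separated-≤-covering {R = R} R-equiv x y x-sep covered = injective⇒≤ class-injective
  where
  open IsEquivalence R-equiv renaming (sym to R-sym; trans to R-trans) using ()
  class-injective : Injective _≡_ _≡_ (proj₁ ∘ covered)
  class-injective {i} {j} e = x-sep i j (R-trans (proj₂ (covered i))
    (R-sym (subst (R (x j) ∘ y) (sym e) (proj₂ (covered j)))))

unique-lookup-injective : {A : Set} {xs : List A} → Unique xs →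
  ∀ i j → lookup xs i ≡ lookup xs j → i ≡ j
unique-lookup-injective (_ ∷ _) zero zero _ = refl
unique-lookup-injective (x∉xs ∷ _) zero (suc j) e =
  contradiction e (All.lookup x∉xs (∈-lookup j))
unique-lookup-injective (x∉xs ∷ _) (suc i) zero e =
  contradiction (sym e) (All.lookup x∉xs (∈-lookup i))
unique-lookup-injective (_ ∷ xs!) (suc i) (suc j) e = cong suc (unique-lookup-injective xs! i j e)

decidable⇒numClasses : ∀ {N} {Q : Fin N → Set} → Decidable Q → ∃[ m ] NumClasses Q _≡_ m
decidable⇒numClasses {N} Q? =
  length xs , lookup xs ,
  (λ i → proj₂ (∈-filter⁻ Q? {xs = allFin N} (∈-lookup i))) ,
  unique-lookup-injective (filter⁺ Q? (allFin⁺ N)) ,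
  λ x q → let x∈xs = ∈-filter⁺ Q? (∈-allFin x) q in index x∈xs , lookup-index x∈xs
  where xs = filter Q? (allFin N)

≗c-isEquivalence : ∀ {n} → IsEquivalence (_≗c_ {n})
≗c-isEquivalence {n} = Setoid.isEquivalence (Fin n →-setoid ℕ)

funToFin-cong : ∀ {m n} {f g : Fin m → Fin n} → f ≗ g → funToFin f ≡ funToFin g
funToFin-cong {zero} _ = refl
funToFin-cong {suc m} f≗g = cong₂ combine (f≗g zero) (funToFin-cong (f≗g ∘ suc))

finToFun-injective : ∀ {m n} {i j : Fin (n ^ m)} → finToFun {n} {m} i ≗ finToFun j → i ≡ j
finToFun-injective {m} {n} {i} {j} e = begin
  i                               ≡⟨ funToFin-finToFin {m} {n} i ⟨
  funToFin (finToFun {n} {m} i)   ≡⟨ funToFin-cong e ⟩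
  funToFin (finToFun {n} {m} j)   ≡⟨ funToFin-finToFin {m} {n} j ⟩
  j                               ∎
  where open ≡-Reasoning

remQuot-injective : ∀ {c} a {z z′ : Fin (c * a)} →
  quotient {c} a z ≡ quotient {c} a z′ → remainder {c} a z ≡ remainder {c} a z′ → z ≡ z′
remQuot-injective {c} a {z} {z′} e₁ e₂ =
  trans (sym (combine-remQuot {c} a z)) (trans (cong₂ combine e₁ e₂) (combine-remQuot {c} a z′))

module _ {n : ℕ} (G : Graph n) where

  isProper? : Decidable (IsProper G)
  isProper? f = all? λ u → all? λ v → (adj G u v ≟ᵇ true) →-dec ¬? (f u ≟ⁿ f v)

  isProper-resp : ∀ {f g} → IsProper G f → f ≗ g → IsProper G g
  isProper-resp proper f≗g u v uv fu≡fv = proper u v uv (trans (f≗g u) (trans fu≡fv (sym (f≗g v))))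

  ∘ₚ-isAut : ∀ {π ρ} → IsAut G π → IsAut G ρ → IsAut G (π ∘ₚ ρ)
  ∘ₚ-isAut π-aut ρ-aut u v = trans (ρ-aut _ _) (π-aut u v)

  flip-isAut : ∀ {π} → IsAut G π → IsAut G (flip π)
  flip-isAut {π} π-aut u v = trans (sym (π-aut _ _)) (cong₂ (adj G) (inverseʳ π) (inverseʳ π))

  iter-invariant : ∀ {ρ} (f : Coloring n) → (f ∘ (ρ ⟨$⟩ʳ_)) ≗ f →
    ∀ m u → f (iter ρ m u) ≡ f u
  iter-invariant f fixed zero u = refl
  iter-invariant f fixed (suc m) u = trans (fixed _) (iter-invariant f fixed m u)

  fixesProper⇒identity :
    (∀ π → IsAut G π → ¬ IsIdentity π → SomeCycleHasEdge G π) →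
    ∀ {f ρ} → IsProper G f → IsAut G ρ → (f ∘ (ρ ⟨$⟩ʳ_)) ≗ f → IsIdentity ρ
  fixesProper⇒identity cycleEdge {f} {ρ} proper ρ-aut fixed =
    decidable-stable (all? λ v → ρ ⟨$⟩ʳ v ≟ᶠ v) λ nonIdentity →
      let (u , v , m , uv , ρᵐu≡v) = cycleEdge ρ ρ-aut nonIdentity
      in proper u v uv (trans (sym (iter-invariant f fixed m u)) (cong f ρᵐu≡v))

  endo : Fin (n ^ n) → Fin n → Fin n
  endo = finToFun

  -- Automorphisms are enumerated through codes of maps Fin n → Fin n; a code
  -- qualifies when it has an inverse code and the map preserves adjacency.
  AutCode : Fin (n ^ n) → Set
  AutCode i = ∃[ j ] (∀ x → endo i (endo j x) ≡ x) × (∀ x → endo j (endo i x) ≡ x) ×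
              (∀ u v → adj G (endo i u) (endo i v) ≡ adj G u v)

  autCode? : Decidable AutCode
  autCode? i = any? λ j →
    (all? λ x → endo i (endo j x) ≟ᶠ x) ×-dec (all? λ x → endo j (endo i x) ≟ᶠ x) ×-dec
    (all? λ u → all? λ v → adj G (endo i u) (endo i v) ≟ᵇ adj G u v)

  decodeAut : ∀ i → AutCode i → Permutation′ n
  decodeAut i (j , ij , ji , _) = permutation (endo i) (endo j) ij ji

  encodeAut : Permutation′ n → Fin (n ^ n)
  encodeAut π = funToFin (π ⟨$⟩ʳ_)

  encodeAut-autCode : ∀ {π} → IsAut G π → AutCode (encodeAut π)
  encodeAut-autCode {π} π-aut =
    funToFin (π ⟨$⟩ˡ_) ,
    (λ x → trans (decode-π _) (trans (cong (π ⟨$⟩ʳ_) (decode-π⁻¹ x)) (inverseʳ π))) ,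
    (λ x → trans (decode-π⁻¹ _) (trans (cong (π ⟨$⟩ˡ_) (decode-π x)) (inverseˡ π))) ,
    λ u v → trans (cong₂ (adj G) (decode-π u) (decode-π v)) (π-aut u v)
    where
    decode-π : endo (funToFin (π ⟨$⟩ʳ_)) ≗ π ⟨$⟩ʳ_
    decode-π = finToFun-funToFin (π ⟨$⟩ʳ_)
    decode-π⁻¹ : endo (funToFin (π ⟨$⟩ˡ_)) ≗ π ⟨$⟩ˡ_
    decode-π⁻¹ = finToFun-funToFin (π ⟨$⟩ˡ_)

  countAutomorphisms : ∃[ a ] NumClasses (IsAut G) _≈_ a
  countAutomorphisms =
    let (a , codes) = decidable⇒numClasses autCode? in
    a , numClasses-transport {R = _≡_} {Q = IsAut G} {S = _≈_} decodeAut (λ π _ → encodeAut π)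
          (λ { _ (_ , _ , _ , aut) → aut })
          (λ _ _ _ _ → finToFun-injective)
          (λ π → encodeAut-autCode {π})
          (λ { π _ _ _ refl v → sym (finToFun-funToFin (π ⟨$⟩ʳ_) v) })
          codes

module _ {n k : ℕ} (G : Graph n) (L : Assignment n k) where

  coloringOf : Fin (k ^ n) → Coloring n
  coloringOf i v = list L v (finToFun {k} {n} i v)

  encodeColoring : (f : Coloring n) → (∀ v → ∃[ j ] list L v j ≡ f v) → Fin (k ^ n)
  encodeColoring f fromL = funToFin (λ v → proj₁ (fromL v))

  coloringOf-encode : (f : Coloring n) (fromL : ∀ v → ∃[ j ] list L v j ≡ f v) →
    coloringOf (encodeColoring f fromL) ≗ f
  coloringOf-encode f fromL v =
    trans (cong (list L v) (finToFun-funToFin (λ v → proj₁ (fromL v)) v)) (proj₂ (fromL v))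

  countLColorings : ∃[ m ] NumLColorings G L m
  countLColorings =
    let (m , codes) = decidable⇒numClasses (isProper? G ∘ coloringOf) in
    m , numClasses-transport {R = _≡_} {Q = IsProperL G L} {S = _≗c_}
          (λ i _ → coloringOf i) (λ f (fromL , _) → encodeColoring f fromL)
          (λ i proper → (λ v → finToFun {k} {n} i v , refl) , proper)
          (λ _ _ _ _ e → finToFun-injective (λ v → distinct L v (e v)))
          (λ f (fromL , proper) → isProper-resp G proper (λ v → sym (coloringOf-encode f fromL v)))
          (λ { f (fromL , _) _ _ refl v → sym (coloringOf-encode f fromL v) })
          codes

  isProperL-∘aut : (∀ u v j → list L u j ≡ list L v j) →
    ∀ {π f} → IsAut G π → IsProperL G L f → IsProperL G L (f ∘ (π ⟨$⟩ʳ_))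
  isProperL-∘aut uniform {π} π-aut (fromL , proper) =
    (λ v → let (j , e) = fromL (π ⟨$⟩ʳ v) in j , trans (uniform v _ j) e) ,
    λ u v uv → proper _ _ (trans (π-aut u v) uv)

bounded⇒inFullPalette : ∀ {k c} → 1 ≤ c → c ≤ k → ∃[ j ] suc (toℕ {k} j) ≡ c
bounded⇒inFullPalette {c = suc _} (s≤s z≤n) c≤k = fromℕ< c≤k , cong suc (toℕ-fromℕ< c≤k)

inFullPalette⇒bounded : ∀ {k c} → ∃[ j ] suc (toℕ {k} j) ≡ c → 1 ≤ c × c ≤ k
inFullPalette⇒bounded (j , refl) = s≤s z≤n , toℕ<n j

module _ {n : ℕ} (G : Graph n) (k : ℕ) where

  relabelled-adj : (h : Fin n → Fin n → Bool) (σ : Permutation′ n) →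
    (∀ x y → h x y ≡ permAdj σ (adj G) x y) →
    ∀ u v → h (σ ⟨$⟩ʳ u) (σ ⟨$⟩ʳ v) ≡ adj G u v
  relabelled-adj _ σ h≡σG u v = trans (h≡σG _ _) (cong₂ (adj G) (inverseˡ σ) (inverseˡ σ))

  -- A pair (σ·G, f) corresponds to the colouring f ∘ σ of G itself.
  pairColoring : (x : Pair n) → IsHanlonPair G k x → Coloring n
  pairColoring (_ , f) ((σ , _) , _) = f ∘ (σ ⟨$⟩ʳ_)

  pairColoring-isProperL : ∀ x p → IsProperL G (fullAssignment n k) (pairColoring x p)
  pairColoring-isProperL (h , f) ((σ , h≡σG) , bounded , proper) =
    (λ v → let (1≤c , c≤k) = bounded (σ ⟨$⟩ʳ v) in bounded⇒inFullPalette 1≤c c≤k) ,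
    λ u v uv → proper _ _ (trans (relabelled-adj h σ h≡σG u v) uv)

  autEquiv⇒sameOrbit : ∀ x x′ p p′ →
    AutEquiv G (pairColoring x p) (pairColoring x′ p′) → SameOrbit x x′
  autEquiv⇒sameOrbit (h , f) (h′ , f′) ((σ , h≡σG) , _) ((σ′ , h′≡σ′G) , _)
    (π , π-aut , fσπ≗f′σ′) =
    flip σ ∘ₚ flip π ∘ₚ σ′ ,
    (λ x y → trans (h′≡σ′G x y)
      (trans (sym (π-aut _ _)) (sym (relabelled-adj h σ h≡σG _ _)))) ,
    λ x → trans (cong f′ (sym (inverseʳ σ′))) (sym (fσπ≗f′σ′ _))

  coloring-isHanlonPair : (f : Coloring n) →
    IsProperL G (fullAssignment n k) f → IsHanlonPair G k (adj G , f)
  coloring-isHanlonPair f (fromL , proper) =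
    (id , λ _ _ → refl) , (λ v → inFullPalette⇒bounded (fromL v)) , proper

  sameOrbit⇒autEquiv : (f : Coloring n) → IsProperL G (fullAssignment n k) f →
    (x : Pair n) (p : IsHanlonPair G k x) →
    SameOrbit (adj G , f) x → AutEquiv G f (pairColoring x p)
  sameOrbit⇒autEquiv f _ (h , g) ((σ , h≡σG) , _) (τ , h≡τG , g≡fτ⁻¹) =
    σ ∘ₚ flip τ ,
    (λ u v → trans (sym (h≡τG _ _)) (relabelled-adj h σ h≡σG u v)) ,
    λ v → sym (g≡fτ⁻¹ _)

  hanlonOrbits⇒autClasses : ∀ {pu} →
    UnlabeledChromPoly G k pu → UnlabeledLCount G (fullAssignment n k) pu
  hanlonOrbits⇒autClasses = numClasses-transport {R = SameOrbit} {S = AutEquiv G}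
    pairColoring (λ f _ → adj G , f)
    pairColoring-isProperL autEquiv⇒sameOrbit coloring-isHanlonPair sameOrbit⇒autEquiv

module _ {n : ℕ} {c a : ℕ} (U : Fin c → Coloring n) (α : Fin a → Permutation′ n) where

  translate : Fin (c * a) → Coloring n
  translate z = U (quotient {c} a z) ∘ (α (remainder {c} a z) ⟨$⟩ʳ_)

  translate-combine : ∀ t s → translate (combine t s) ≗ U t ∘ (α s ⟨$⟩ʳ_)
  translate-combine t s v = cong (λ (t′ , s′) → U t′ (α s′ ⟨$⟩ʳ v)) (remQuot-combine t s)

module _ {n k : ℕ} (G : Graph n) (L : Assignment n k) {c a m : ℕ} where

  classes*automorphisms≤colorings :
    (∀ π → IsAut G π → ¬ IsIdentity π → SomeCycleHasEdge G π) →
    (∀ u v j → list L u j ≡ list L v j) →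
    UnlabeledLCount G L c → NumClasses (IsAut G) _≈_ a → NumLColorings G L m → c * a ≤ m
  classes*automorphisms≤colorings cycleEdge uniform
    (U , U-properL , U-sep , _) (α , α-aut , α-sep , _) (rep , _ , _ , cover) =
    separated-≤-covering (≗c-isEquivalence {n}) (translate U α) rep translate-separated
      λ z → cover _ (translate-properL z)
    where
    translate-properL : ∀ z → IsProperL G L (translate U α z)
    translate-properL z = isProperL-∘aut G L uniform {α (remainder {c} a z)} {U (quotient {c} a z)}
      (α-aut (remainder {c} a z)) (U-properL (quotient {c} a z))

    separated : ∀ {t s t′ s′} →
      U t ∘ (α s ⟨$⟩ʳ_) ≗ U t′ ∘ (α s′ ⟨$⟩ʳ_) → t ≡ t′ × s ≡ s′
    separated {t} {s} {t′} {s′} e = sym t′≡t , α-sep s s′ αs≈αs′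
      where
      ρ : Permutation′ n
      ρ = flip (α s) ∘ₚ α s′
      ρ-aut : IsAut G ρ
      ρ-aut = ∘ₚ-isAut G {flip (α s)} {α s′} (flip-isAut G {α s} (α-aut s)) (α-aut s′)
      Ut′∘ρ≗Ut : U t′ ∘ (ρ ⟨$⟩ʳ_) ≗ U t
      Ut′∘ρ≗Ut v = trans (sym (e _)) (cong (U t) (inverseʳ (α s)))
      t′≡t : t′ ≡ t
      t′≡t = U-sep t′ t (ρ , ρ-aut , Ut′∘ρ≗Ut)
      ρ-identity : IsIdentity ρ
      ρ-identity = fixesProper⇒identity G cycleEdge {U t} {ρ} (proj₂ (U-properL t)) ρ-aut
        (subst (λ t″ → U t″ ∘ (ρ ⟨$⟩ʳ_) ≗ U t) t′≡t Ut′∘ρ≗Ut)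
      αs≈αs′ : α s ≈ α s′
      αs≈αs′ v = trans (sym (ρ-identity _)) (cong (α s′ ⟨$⟩ʳ_) (inverseˡ (α s)))

    translate-separated : ∀ z z′ → translate U α z ≗ translate U α z′ → z ≡ z′
    translate-separated z z′ e =
      let (t≡t′ , s≡s′) = separated e in remQuot-injective a t≡t′ s≡s′

  colorings≤classes*automorphisms :
    UnlabeledLCount G L c → NumClasses (IsAut G) _≈_ a → NumLColorings G L m → m ≤ c * a
  colorings≤classes*automorphisms
    (U , _ , _ , U-cover) (α , _ , _ , α-cover) (rep , rep-properL , rep-sep , _) =
    separated-≤-covering (≗c-isEquivalence {n}) rep (translate U α) rep-sep
      (λ r → covered (rep-properL r))
    where
    covered : ∀ {f} → IsProperL G L f → ∃[ z ] f ≗ translate U α z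
    covered {f} properL =
      let (t , π , π-aut , fπ≗Ut) = U-cover f properL
          (s , π⁻¹≈αs) = α-cover (flip π) (flip-isAut G {π} π-aut)
      in combine t s , λ v → begin
        f v                              ≡⟨ cong f (inverseʳ π) ⟨
        f (π ⟨$⟩ʳ (π ⟨$⟩ˡ v))            ≡⟨ fπ≗Ut _ ⟩
        U t (π ⟨$⟩ˡ v)                   ≡⟨ cong (U t) (π⁻¹≈αs v) ⟩
        U t (α s ⟨$⟩ʳ v)                 ≡⟨ translate-combine U α t s v ⟨
        translate U α (combine t s) v    ∎
      where open ≡-Reasoning

proposition2p3 : (n : ℕ) (G : Graph n) →
    (∀ (π : Permutation′ n) → IsAut G π → ¬ IsIdentity π → SomeCycleHasEdge G π) →
    (k p pu : ℕ) → ChromPoly G k p → UnlabeledChromPoly G k pu →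
    ListColorFn G k p → UnlabeledListColorFn G k pu
proposition2p3 n G cycleEdge k p pu chrom hanlon (_ , p-minimal) =
  (fullAssignment n k , fullClasses) , pu-minimal
  where
  fullClasses : UnlabeledLCount G (fullAssignment n k) pu
  fullClasses = hanlonOrbits⇒autClasses G k hanlon

  pu-minimal : ∀ L c → UnlabeledLCount G L c → pu ≤ c
  pu-minimal L c classes =
    let (a , automorphisms) = countAutomorphisms G
        (m , lcolorings) = countLColorings G L
        instance a≢0 = numClasses-nonZero {R = _≈_} {x = id} automorphisms (λ _ _ → refl)
    in *-cancelʳ-≤ pu c a (begin
      pu * a  ≤⟨ classes*automorphisms≤colorings G (fullAssignment n k) cycleEdge (λ _ _ _ → refl)
                   fullClasses automorphisms chrom ⟩
      p       ≤⟨ p-minimal L m lcolorings ⟩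
      m       ≤⟨ colorings≤classes*automorphisms G L classes automorphisms lcolorings ⟩
      c * a   ∎)
    where open ≤-Reasoning
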